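{- For every integer $n\geq 3$, $\chi_{md}(C_n\circ K_1)=\left\lceil \frac{n}{2}\right\rceil+1$.
   Context: $C_n$ is the cycle on $n$ vertices. The corona $G\circ K_1$ is obtained from $G$ by attaching to each vertex of $G$ one new pendant vertex (adjacent only to it). For a vertex $v$, $N[v]=N(v)\cup\{v\}$; $v$ dominates exactly the vertices of $N[v]$. A majority dominator coloring of $G$ is a proper vertex coloring such that for every vertex $v$ there is a color class $C$ with $|N[v]\cap C|\geq |C|/2$. $\chi_{md}(G)$ is the minimum number of color classes in a majority dominator coloring of $G$. -}

module Defs where

open import Data.Nat using (ℕ; zero; suc; _+_; _*_; _≤_; _≡ᵇ_; ⌈_/2⌉)
open import Data.Fin using (Fin; toℕ; splitAt; _≟_) renaming (zero to fzero; suc to fsuc)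
open import Data.Bool using (Bool; true; false; _∨_; _∧_; if_then_else_)
open import Data.Sum using (inj₁; inj₂)
open import Data.Product using (∃; _×_)
open import Relation.Nullary using (¬_)
open import Relation.Nullary.Decidable using (⌊_⌋)
open import Relation.Binary.PropositionalEquality using (_≡_; _≢_)

record Graph : Set where
  field
    size : ℕ
    adj  : Fin size → Fin size → Bool
open Graph public

count : {m : ℕ} → (Fin m → Bool) → ℕ
count {zero}  f = 0
count {suc m} f = (if f fzero then 1 else 0) + count (λ x → f (fsuc x))

succMod : ℕ → ℕ → ℕ → Bool
succMod n a b = (suc a ≡ᵇ b) ∨ ((suc a ≡ᵇ n) ∧ (b ≡ᵇ 0))

Cycle : ℕ → Graph
Cycle n = record
  { size = n
  ; adj  = λ i j → succMod n (toℕ i) (toℕ j) ∨ succMod n (toℕ j) (toℕ i) }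

-- Corona G ∘ K₁: vertices Fin (size G + size G); the first copy is G,
-- vertex (size G + i) is a pendant vertex adjacent only to vertex i.
corona : Graph → Graph
corona G = record { size = size G + size G ; adj = a }
  where
    a : Fin (size G + size G) → Fin (size G + size G) → Bool
    a x y with splitAt (size G) x | splitAt (size G) y
    ... | inj₁ i | inj₁ j = adj G i j
    ... | inj₁ i | inj₂ j = ⌊ i ≟ j ⌋
    ... | inj₂ i | inj₁ j = ⌊ i ≟ j ⌋
    ... | inj₂ i | inj₂ j = false

closedNbhd : (G : Graph) → Fin (size G) → Fin (size G) → Bool
closedNbhd G v u = ⌊ u ≟ v ⌋ ∨ adj G v u

-- A coloring with exactly k color classes (all nonempty): a surjection onto Fin k.
Proper : (G : Graph) {k : ℕ} → (Fin (size G) → Fin k) → Set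
Proper G c = ∀ u v → adj G u v ≡ true → c u ≢ c v

AllClassesNonempty : (G : Graph) {k : ℕ} → (Fin (size G) → Fin k) → Set
AllClassesNonempty G {k} c = ∀ (i : Fin k) → ∃ λ v → c v ≡ i

-- every vertex v has a color class C with |N[v] ∩ C| ≥ |C|/2, i.e. 2|N[v] ∩ C| ≥ |C|
MajorityDominating : (G : Graph) {k : ℕ} → (Fin (size G) → Fin k) → Set
MajorityDominating G {k} c =
  ∀ v → ∃ λ (i : Fin k) →
    count (λ u → ⌊ c u ≟ i ⌋) ≤ 2 * count (λ u → closedNbhd G v u ∧ ⌊ c u ≟ i ⌋)

IsMDColoring : (G : Graph) {k : ℕ} → (Fin (size G) → Fin k) → Set
IsMDColoring G c = Proper G c × AllClassesNonempty G c × MajorityDominating G c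

HasMDColoring : Graph → ℕ → Set
HasMDColoring G k = ∃ λ (c : Fin (size G) → Fin k) → IsMDColoring G c

χmd≡ : Graph → ℕ → Set
χmd≡ G m = HasMDColoring G m × (∀ k → HasMDColoring G k → m ≤ k)

module Submission where

-- Lower bound, for the corona of any graph on N ≥ 2 vertices. Call a color class small if it has at
-- most two vertices. A pendant p sees only itself and its neighbor v, which have different colors,
-- so a class majority-dominating p meets N[p] in one vertex and is therefore small; it contains p or
-- v. The N spokes {v, p} are disjoint, so at least N vertices carry small colors, and as small
-- classes have at most two vertices there are at least ⌈N/2⌉ small colors. If some color is not
-- small this gives ⌈N/2⌉ + 1 colors; otherwise all 2N vertices lie in small classes, giving at
-- least N ≥ ⌈N/2⌉ + 1 colors.
--
-- Upper bound: give color j < ⌈n/2⌉ to cycle vertex 2j and to the pendant of cycle vertex 2j + 1,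
-- and one further color to every other vertex. For n ≥ 3 this is proper, and every spoke contains
-- a vertex of a class of size at most two, which majority-dominates both ends of the spoke.

open import Defs
open import Data.Nat using (ℕ; zero; suc; _+_; _*_; _≤_; _<_; _≤?_; _≡ᵇ_; z≤n; s≤s; ⌊_/2⌋; ⌈_/2⌉)
open import Data.Nat.Properties hiding (_≟_)
open import Data.Fin using (Fin; toℕ; splitAt; join; fromℕ<; _↑ˡ_; _↑ʳ_; _≟_) renaming (zero to fzero; suc to fsuc)
open import Data.Fin.Properties using (splitAt-↑ˡ; splitAt-↑ʳ; join-splitAt; toℕ-fromℕ<; toℕ-injective; toℕ<n) renaming (suc-injective to fsuc-injective)
open import Data.Bool using (Bool; true; false; not; _∨_; _∧_; if_then_else_)
open import Data.Bool.Properties using (T-≡; ∨-zeroʳ; not-injective)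
open import Data.Sum using (_⊎_; inj₁; inj₂; swap; [_,_]′)
open import Data.Product using (∃; _×_; _,_)
open import Function using (_∘_; Equivalence)
open import Relation.Nullary using (Dec; contradiction)
open import Relation.Nullary.Decidable using (⌊_⌋; toWitness; fromWitness; ⌊⌋-map′)
open import Relation.Binary.PropositionalEquality
open import Algebra.Properties.Semiring.Sum +-*-semiring using (sum; sum-syntax; ∑-comm; sum-cong-≗; sum-replicate-zero; *-distribˡ-sum; *-distribʳ-sum)

𝟙 : Bool → ℕ
𝟙 b = if b then 1 else 0

∨≡true⁻ : ∀ x {y} → x ∨ y ≡ true → x ≡ true ⊎ y ≡ true
∨≡true⁻ true  _ = inj₁ refl
∨≡true⁻ false e = inj₂ e

∧≡true⁻ : ∀ x {y} → x ∧ y ≡ true → x ≡ true × y ≡ true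
∧≡true⁻ true e = refl , e

toWitness′ : ∀ {P : Set} {d : Dec P} → ⌊ d ⌋ ≡ true → P
toWitness′ e = toWitness (Equivalence.from T-≡ e)

fromWitness′ : ∀ {P : Set} {d : Dec P} → P → ⌊ d ⌋ ≡ true
fromWitness′ p = Equivalence.to T-≡ (fromWitness p)

≡ᵇ⇒≡′ : ∀ {a b} → (a ≡ᵇ b) ≡ true → a ≡ b
≡ᵇ⇒≡′ e = ≡ᵇ⇒≡ _ _ (Equivalence.from T-≡ e)

count≡∑ : ∀ {m} (f : Fin m → Bool) → count f ≡ sum (𝟙 ∘ f)
count≡∑ {zero}  f = refl
count≡∑ {suc m} f = cong (𝟙 (f fzero) +_) (count≡∑ (f ∘ fsuc))

count-≤ : ∀ {m} (f : Fin m → Bool) → count f ≤ m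
count-≤ {zero}  f = z≤n
count-≤ {suc m} f with f fzero
... | true  = s≤s (count-≤ (f ∘ fsuc))
... | false = m≤n⇒m≤1+n (count-≤ (f ∘ fsuc))

count-pos : ∀ {m} (f : Fin m → Bool) {x} → f x ≡ true → 1 ≤ count f
count-pos f {fzero}  fx rewrite fx = s≤s z≤n
count-pos f {fsuc x} fx = ≤-trans (count-pos (f ∘ fsuc) fx) (m≤n+m _ _)

count-pos⁻¹ : ∀ {m} (f : Fin m → Bool) → 1 ≤ count f → ∃ λ x → f x ≡ true
count-pos⁻¹ {suc m} f pos with f fzero in fz
... | true  = fzero , fz
... | false with count-pos⁻¹ (f ∘ fsuc) pos
...   | x , fx = fsuc x , fx

count-≤1 : ∀ {m} (f : Fin m → Bool) → (∀ {x y} → f x ≡ true → f y ≡ true → x ≡ y) → count f ≤ 1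
count-≤1 {zero}  f unique = z≤n
count-≤1 {suc m} f unique with f fzero in fz
... | true  = s≤s (≮⇒≥ λ pos → let (x , fx) = count-pos⁻¹ (f ∘ fsuc) pos in contradiction (unique fz fx) λ ())
... | false = count-≤1 (f ∘ fsuc) (λ fx fy → fsuc-injective (unique fx fy))

count-all : ∀ {m} (f : Fin m → Bool) → (∀ x → f x ≡ true) → count f ≡ m
count-all {zero}  f all = refl
count-all {suc m} f all rewrite all fzero = cong suc (count-all (f ∘ fsuc) (all ∘ fsuc))

count-all-or-< : ∀ {m} (f : Fin m → Bool) → (∀ x → f x ≡ true) ⊎ count f < m
count-all-or-< {zero}  f = inj₁ λ ()
count-all-or-< {suc m} f with f fzero in fz | count-all-or-< (f ∘ fsuc)
... | true  | inj₁ all = inj₁ λ { fzero → fz ; (fsuc x) → all x }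
... | true  | inj₂ lt  = inj₂ (s≤s lt)
... | false | _        = inj₂ (s≤s (count-≤ (f ∘ fsuc)))

count-++ : ∀ m {n} (f : Fin (m + n) → Bool) →
           count f ≡ count (λ i → f (i ↑ˡ n)) + count (λ i → f (m ↑ʳ i))
count-++ zero    f = refl
count-++ (suc m) f = trans (cong (𝟙 (f fzero) +_) (count-++ m (f ∘ fsuc))) (sym (+-assoc (𝟙 (f fzero)) _ _))

count-cover : ∀ {m} (f g : Fin m → Bool) → (∀ x → f x ≡ true ⊎ g x ≡ true) → m ≤ count f + count g
count-cover {zero}  f g cover = z≤n
count-cover {suc m} f g cover with f fzero | g fzero | cover fzero | count-cover (f ∘ fsuc) (g ∘ fsuc) (cover ∘ fsuc)
... | true  | _     | _        | ih = s≤s (≤-trans ih (+-monoʳ-≤ (count (f ∘ fsuc)) (m≤n+m (count (g ∘ fsuc)) _)))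
... | false | true  | _        | ih = ≤-trans (s≤s ih) (≤-reflexive (sym (+-suc _ _)))
... | false | false | inj₁ ()  | _
... | false | false | inj₂ ()  | _

∑-mono-≤ : ∀ {m} {f g : Fin m → ℕ} → (∀ x → f x ≤ g x) → sum f ≤ sum g
∑-mono-≤ {zero}  f≤g = z≤n
∑-mono-≤ {suc m} f≤g = +-mono-≤ (f≤g fzero) (∑-mono-≤ (f≤g ∘ fsuc))

∑-point : ∀ {k} (x : Fin k) (g : Fin k → ℕ) → sum (λ i → 𝟙 ⌊ x ≟ i ⌋ * g i) ≡ g x
∑-point {suc k} fzero    g = trans (cong₂ _+_ (+-identityʳ (g fzero)) (sum-replicate-zero k)) (+-identityʳ (g fzero))
∑-point {suc k} (fsuc x) g =
  trans (sum-cong-≗ λ i → cong (λ b → 𝟙 b * g (fsuc i)) (⌊⌋-map′ _ _ (x ≟ i))) (∑-point x (g ∘ fsuc))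

count-∘-≤ : ∀ {N k} b (f : Fin N → Fin k) (s : Fin k → Bool) →
            (∀ i → s i ≡ true → count (λ u → ⌊ f u ≟ i ⌋) ≤ b) →
            count (s ∘ f) ≤ b * count s
count-∘-≤ {N} {k} b f s fibre≤ = begin
  count (s ∘ f)                                      ≡⟨ count≡∑ (s ∘ f) ⟩
  ∑[ u < N ] 𝟙 (s (f u))                             ≡⟨ sum-cong-≗ (λ u → ∑-point (f u) (𝟙 ∘ s)) ⟨
  ∑[ u < N ] ∑[ i < k ] (𝟙 ⌊ f u ≟ i ⌋ * 𝟙 (s i))    ≡⟨ ∑-comm (λ u i → 𝟙 ⌊ f u ≟ i ⌋ * 𝟙 (s i)) ⟩
  ∑[ i < k ] ∑[ u < N ] (𝟙 ⌊ f u ≟ i ⌋ * 𝟙 (s i))    ≡⟨ sum-cong-≗ (λ i → *-distribʳ-sum (𝟙 (s i)) (λ u → 𝟙 ⌊ f u ≟ i ⌋)) ⟨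
  ∑[ i < k ] ((∑[ u < N ] 𝟙 ⌊ f u ≟ i ⌋) * 𝟙 (s i))  ≡⟨ sum-cong-≗ (λ i → cong (_* 𝟙 (s i)) (count≡∑ (λ u → ⌊ f u ≟ i ⌋))) ⟨
  ∑[ i < k ] (count (λ u → ⌊ f u ≟ i ⌋) * 𝟙 (s i))   ≤⟨ ∑-mono-≤ weighted ⟩
  ∑[ i < k ] (b * 𝟙 (s i))                           ≡⟨ *-distribˡ-sum b (𝟙 ∘ s) ⟨
  b * ∑[ i < k ] 𝟙 (s i)                             ≡⟨ cong (b *_) (count≡∑ s) ⟨
  b * count s                                        ∎
  where
  open ≤-Reasoning
  weighted : ∀ i → count (λ u → ⌊ f u ≟ i ⌋) * 𝟙 (s i) ≤ b * 𝟙 (s i)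
  weighted i with s i in si
  ... | true  = *-monoˡ-≤ 1 (fibre≤ i si)
  ... | false = ≤-reflexive (trans (*-zeroʳ (count (λ u → ⌊ f u ≟ i ⌋))) (sym (*-zeroʳ b)))

base : (G : Graph) → Fin (size G) → Fin (size (corona G))
base G i = i ↑ˡ size G

pendant : (G : Graph) → Fin (size G) → Fin (size (corona G))
pendant G i = size G ↑ʳ i

Spoke : (G : Graph) → Fin (size G) → Fin (size (corona G)) → Set
Spoke G i u = u ≡ base G i ⊎ u ≡ pendant G i

corona-spoke : ∀ G x → ∃ λ i → Spoke G i x
corona-spoke G x with splitAt (size G) x in e
... | inj₁ i = i , inj₁ (trans (sym (join-splitAt (size G) (size G) x)) (cong (join (size G) (size G)) e))
... | inj₂ i = i , inj₂ (trans (sym (join-splitAt (size G) (size G) x)) (cong (join (size G) (size G)) e))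

module _ (G : Graph) (i j : Fin (size G)) where

  adj-base-base : adj (corona G) (base G i) (base G j) ≡ adj G i j
  adj-base-base rewrite splitAt-↑ˡ (size G) i (size G) | splitAt-↑ˡ (size G) j (size G) = refl

  adj-base-pendant : adj (corona G) (base G i) (pendant G j) ≡ ⌊ i ≟ j ⌋
  adj-base-pendant rewrite splitAt-↑ˡ (size G) i (size G) | splitAt-↑ʳ (size G) (size G) j = refl

  adj-pendant-base : adj (corona G) (pendant G i) (base G j) ≡ ⌊ i ≟ j ⌋
  adj-pendant-base rewrite splitAt-↑ʳ (size G) (size G) i | splitAt-↑ˡ (size G) j (size G) = refl

  adj-pendant-pendant : adj (corona G) (pendant G i) (pendant G j) ≡ false
  adj-pendant-pendant rewrite splitAt-↑ʳ (size G) (size G) i | splitAt-↑ʳ (size G) (size G) j = refl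

pendant-adj-base : ∀ G i → adj (corona G) (pendant G i) (base G i) ≡ true
pendant-adj-base G i = trans (adj-pendant-base G i i) (fromWitness′ refl)

closedNbhd-self : ∀ H x → closedNbhd H x x ≡ true
closedNbhd-self H x = cong (_∨ adj H x x) (fromWitness′ refl)

closedNbhd-adj : ∀ H {x u} → adj H x u ≡ true → closedNbhd H x u ≡ true
closedNbhd-adj H {x} {u} e = trans (cong (⌊ u ≟ x ⌋ ∨_) e) (∨-zeroʳ _)

closedNbhd-pendant : ∀ G i u → closedNbhd (corona G) (pendant G i) u ≡ true → Spoke G i u
closedNbhd-pendant G i u e with ∨≡true⁻ ⌊ u ≟ pendant G i ⌋ e
... | inj₁ u≡p = inj₂ (toWitness′ u≡p)
... | inj₂ u~p with corona-spoke G u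
...   | j , inj₁ refl = inj₁ (cong (base G) (sym (toWitness′ (trans (sym (adj-pendant-base G i j)) u~p))))
...   | j , inj₂ refl = contradiction (trans (sym (adj-pendant-pendant G i j)) u~p) λ ()

closedNbhd-spoke : ∀ G {i x u} → Spoke G i x → Spoke G i u → closedNbhd (corona G) x u ≡ true
closedNbhd-spoke G (inj₁ refl) (inj₁ refl) = closedNbhd-self (corona G) _
closedNbhd-spoke G (inj₂ refl) (inj₂ refl) = closedNbhd-self (corona G) _
closedNbhd-spoke G {i} (inj₁ refl) (inj₂ refl) =
  closedNbhd-adj (corona G) (trans (adj-base-pendant G i i) (fromWitness′ refl))
closedNbhd-spoke G {i} (inj₂ refl) (inj₁ refl) = closedNbhd-adj (corona G) (pendant-adj-base G i)

classSize : ∀ {N k} → (Fin N → Fin k) → Fin k → ℕ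
classSize c i = count (λ u → ⌊ c u ≟ i ⌋)

small : ∀ {N k} → (Fin N → Fin k) → Fin k → Bool
small c i = ⌊ classSize c i ≤? 2 ⌋

majorityDominated-by-small-class : ∀ H {k} (c : Fin (size H) → Fin k) {x u} →
  closedNbhd H x u ≡ true → classSize c (c u) ≤ 2 →
  ∃ λ i → classSize c i ≤ 2 * count (λ v → closedNbhd H x v ∧ ⌊ c v ≟ i ⌋)
majorityDominated-by-small-class H c {x} {u} u∈N[x] c[u]≤2 =
  c u , ≤-trans c[u]≤2 (*-monoʳ-≤ 2 (count-pos (λ v → closedNbhd H x v ∧ ⌊ c v ≟ c u ⌋) u∈N∩C))
  where
  u∈N∩C : (closedNbhd H x u ∧ ⌊ c u ≟ c u ⌋) ≡ true
  u∈N∩C rewrite u∈N[x] = fromWitness′ refl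

leaf-small : ∀ H {k} {c : Fin (size H) → Fin k} → AllClassesNonempty H c → MajorityDominating H c →
  ∀ {x y} → c x ≢ c y → (∀ u → closedNbhd H x u ≡ true → u ≡ x ⊎ u ≡ y) →
  small c (c x) ≡ true ⊎ small c (c y) ≡ true
leaf-small H {c = c} nonempty md {x} {y} cx≢cy N[x]⊆xy =
  let (i , C≤2N∩C) = md x
      (u , u∈N∩C)  = count-pos⁻¹ (N∩C i) (positive i (count (N∩C i)) C≤2N∩C)
  in  conclude (C-small i C≤2N∩C) (member i u∈N∩C)
  where
  N∩C : Fin _ → Fin (size H) → Bool
  N∩C i v = closedNbhd H x v ∧ ⌊ c v ≟ i ⌋

  member : ∀ i {v} → N∩C i v ≡ true → (v ≡ x ⊎ v ≡ y) × c v ≡ i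
  member i {v} e with ∧≡true⁻ (closedNbhd H x v) e
  ... | v∈N[x] , cv≡i = N[x]⊆xy v v∈N[x] , toWitness′ cv≡i

  N∩C≤1 : ∀ i → count (N∩C i) ≤ 1
  N∩C≤1 i = count-≤1 (N∩C i) (λ eu ev → same (member i eu) (member i ev))
    where
    same : ∀ {u v} → (u ≡ x ⊎ u ≡ y) × c u ≡ i → (v ≡ x ⊎ v ≡ y) × c v ≡ i → u ≡ v
    same (inj₁ refl , _)  (inj₁ refl , _)  = refl
    same (inj₂ refl , _)  (inj₂ refl , _)  = refl
    same (inj₁ refl , cx) (inj₂ refl , cy) = contradiction (trans cx (sym cy)) cx≢cy
    same (inj₂ refl , cy) (inj₁ refl , cx) = contradiction (trans cx (sym cy)) cx≢cy

  C-small : ∀ i → classSize c i ≤ 2 * count (N∩C i) → small c i ≡ true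
  C-small i C≤2N∩C = fromWitness′ (≤-trans C≤2N∩C (*-monoʳ-≤ 2 (N∩C≤1 i)))

  positive : ∀ i b → classSize c i ≤ 2 * b → 1 ≤ b
  positive i zero    C≤0 = let (w , cw≡i) = nonempty i in
    contradiction (≤-trans (count-pos (λ v → ⌊ c v ≟ i ⌋) (fromWitness′ cw≡i)) C≤0) λ ()
  positive i (suc b) _   = s≤s z≤n

  conclude : ∀ {i u} → small c i ≡ true → (u ≡ x ⊎ u ≡ y) × c u ≡ i →
             small c (c x) ≡ true ⊎ small c (c y) ≡ true
  conclude i-small (inj₁ refl , cx≡i) = inj₁ (trans (cong (small c) cx≡i) i-small)
  conclude i-small (inj₂ refl , cy≡i) = inj₂ (trans (cong (small c) cy≡i) i-small)

⌈n/2⌉≤ : ∀ {n} t → n ≤ 2 * t → ⌈ n /2⌉ ≤ t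
⌈n/2⌉≤ t n≤2t = begin
  ⌈ _ /2⌉            ≤⟨ ⌈n/2⌉-mono n≤2t ⟩
  ⌈ t + (t + 0) /2⌉  ≡⟨ cong (λ z → ⌈ t + z /2⌉) (+-identityʳ t) ⟩
  ⌈ t + t /2⌉        ≡⟨ n≡⌈n+n/2⌉ t ⟨
  t                  ∎
  where open ≤-Reasoning

⌈n/2⌉+1≤n : ∀ {n} → 2 ≤ n → ⌈ n /2⌉ + 1 ≤ n
⌈n/2⌉+1≤n {suc zero} (s≤s ())
⌈n/2⌉+1≤n {suc (suc n)} _ = subst (_≤ suc (suc n)) (+-comm 1 _) (⌈n/2⌉<n n)

hasMDColoring-corona-≥ : ∀ G → 2 ≤ size G → ∀ k → HasMDColoring (corona G) k → ⌈ size G /2⌉ + 1 ≤ k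
hasMDColoring-corona-≥ G 2≤N k (c , proper , nonempty , md) =
  [ (λ all-small → ≤-trans (⌈n/2⌉+1≤n 2≤N) (*-cancelˡ-≤ 2 (2N≤2k all-small)))
  , (λ S<k → ≤-trans (+-monoˡ-≤ 1 (⌈n/2⌉≤ (count (small c)) N≤2S)) (subst (_≤ k) (+-comm 1 _) S<k))
  ]′ (count-all-or-< (small c))
  where
  open ≤-Reasoning
  N = size G

  smallVertices≤ : count (small c ∘ c) ≤ 2 * count (small c)
  smallVertices≤ = count-∘-≤ 2 c (small c) (λ _ → toWitness′)

  spoke-small : ∀ i → small c (c (base G i)) ≡ true ⊎ small c (c (pendant G i)) ≡ true
  spoke-small i = swap (leaf-small (corona G) nonempty md (proper _ _ (pendant-adj-base G i))
                                   (λ u → swap ∘ closedNbhd-pendant G i u))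

  N≤2S : N ≤ 2 * count (small c)
  N≤2S = begin
    N                                                               ≤⟨ count-cover _ _ spoke-small ⟩
    count (small c ∘ c ∘ base G) + count (small c ∘ c ∘ pendant G)  ≡⟨ count-++ N (small c ∘ c) ⟨
    count (small c ∘ c)                                             ≤⟨ smallVertices≤ ⟩
    2 * count (small c)                                             ∎

  2N≤2k : (∀ i → small c i ≡ true) → 2 * N ≤ 2 * k
  2N≤2k all-small = begin
    2 * N                ≡⟨ cong (N +_) (+-identityʳ N) ⟩
    N + N                ≡⟨ count-all (small c ∘ c) (all-small ∘ c) ⟨
    count (small c ∘ c)  ≤⟨ smallVertices≤ ⟩
    2 * count (small c)  ≤⟨ *-monoʳ-≤ 2 (count-≤ (small c)) ⟩
    2 * k                ∎

isEven : ℕ → Bool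
isEven zero          = true
isEven (suc zero)    = false
isEven (suc (suc a)) = isEven a

isEven-suc : ∀ a → isEven (suc a) ≡ not (isEven a)
isEven-suc zero          = refl
isEven-suc (suc zero)    = refl
isEven-suc (suc (suc a)) = isEven-suc a

isEven-double : ∀ j → isEven (j + j) ≡ true
isEven-double zero    = refl
isEven-double (suc j) rewrite +-suc j j = isEven-double j

⌊/2⌋-isEven-injective : ∀ a b → ⌊ a /2⌋ ≡ ⌊ b /2⌋ → isEven a ≡ isEven b → a ≡ b
⌊/2⌋-isEven-injective zero          zero          _ _  = refl
⌊/2⌋-isEven-injective (suc zero)    (suc zero)    _ _  = refl
⌊/2⌋-isEven-injective (suc (suc a)) (suc (suc b)) h p  = cong (suc ∘ suc) (⌊/2⌋-isEven-injective a b (suc-injective h) p)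
⌊/2⌋-isEven-injective zero          (suc zero)    _ ()
⌊/2⌋-isEven-injective (suc zero)    zero          _ ()
⌊/2⌋-isEven-injective zero          (suc (suc b)) () _
⌊/2⌋-isEven-injective (suc zero)    (suc (suc b)) () _
⌊/2⌋-isEven-injective (suc (suc a)) zero          () _
⌊/2⌋-isEven-injective (suc (suc a)) (suc zero)    () _

⌊a/2⌋<⌈n/2⌉ : ∀ {a n} → a < n → ⌊ a /2⌋ < ⌈ n /2⌉
⌊a/2⌋<⌈n/2⌉ a<n = ⌊n/2⌋-mono (s≤s a<n)

j<⌈n/2⌉⇒j+j<n : ∀ {j} n → j < ⌈ n /2⌉ → j + j < n
j<⌈n/2⌉⇒j+j<n {zero}  (suc n)       _         = s≤s z≤n
j<⌈n/2⌉⇒j+j<n {suc j} (suc (suc n)) (s≤s j<m) rewrite +-suc j j = s≤s (s≤s (j<⌈n/2⌉⇒j+j<n n j<m))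
j<⌈n/2⌉⇒j+j<n {suc j} (suc zero)    (s≤s ())

succMod-sound : ∀ {n a b} → succMod n a b ≡ true → b ≡ suc a ⊎ (suc a ≡ n × b ≡ 0)
succMod-sound {n} {a} {b} e with ∨≡true⁻ (suc a ≡ᵇ b) e
... | inj₁ next = inj₁ (sym (≡ᵇ⇒≡′ next))
... | inj₂ wrap with ∧≡true⁻ (suc a ≡ᵇ n) wrap
...   | last , first = inj₂ (≡ᵇ⇒≡′ last , ≡ᵇ⇒≡′ first)

module CycleColoring (n : ℕ) (3≤n : 3 ≤ n) where

  G : Graph
  G = Cycle n

  m : ℕ
  m = ⌈ n /2⌉

  -- Cycle vertex a has label a and its pendant label a + 1. The end of the spoke with even label
  -- gets the small color ⌊a/2⌋, the other end the large color m.
  hue : ℕ → ℕ → ℕ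
  hue ℓ a = if isEven ℓ then ⌊ a /2⌋ else m

  hue≤m : ∀ ℓ {a} → a < n → hue ℓ a ≤ m
  hue≤m ℓ a<n with isEven ℓ
  ... | true  = <⇒≤ (⌊a/2⌋<⌈n/2⌉ a<n)
  ... | false = ≤-refl

  hue-even : ∀ ℓ a → isEven ℓ ≡ true → hue ℓ a ≡ ⌊ a /2⌋
  hue-even ℓ a e rewrite e = refl

  hue<m⇒even : ∀ ℓ a → hue ℓ a < m → isEven ℓ ≡ true
  hue<m⇒even ℓ a h with isEven ℓ
  ... | true  = refl
  ... | false = contradiction h (<-irrefl refl)

  hue-injective : ∀ ℓ a ℓ′ b → hue ℓ a ≡ hue ℓ′ b → hue ℓ a < m →
                  isEven ℓ ≡ true × isEven ℓ′ ≡ true × ⌊ a /2⌋ ≡ ⌊ b /2⌋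
  hue-injective ℓ a ℓ′ b eq h = eℓ , eℓ′ , trans (sym (hue-even ℓ a eℓ)) (trans eq (hue-even ℓ′ b eℓ′))
    where
    eℓ  = hue<m⇒even ℓ a h
    eℓ′ = hue<m⇒even ℓ′ b (subst (_< m) eq h)

  hue-consecutive : ∀ ℓ {a b} → a < n → b < n → hue ℓ a ≢ hue (suc ℓ) b
  hue-consecutive ℓ a<n b<n rewrite isEven-suc ℓ with isEven ℓ
  ... | true  = <⇒≢ (⌊a/2⌋<⌈n/2⌉ a<n)
  ... | false = ≢-sym (<⇒≢ (⌊a/2⌋<⌈n/2⌉ b<n))

  hue-last : ∀ {a} → 2 ≤ a → a < n → hue a a ≢ 0
  hue-last {a} 2≤a a<n with isEven a
  ... | true  = ≢-sym (<⇒≢ (⌊n/2⌋-mono 2≤a))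
  ... | false = ≢-sym (<⇒≢ (⌈n/2⌉-mono (≤-trans (s≤s z≤n) a<n)))

  cycle-hue-distinct : ∀ {a b} → a < n → b < n → succMod n a b ≡ true → hue a a ≢ hue b b
  cycle-hue-distinct {a} {b} a<n b<n e with succMod-sound {n} {a} {b} e
  ... | inj₁ refl          = hue-consecutive a a<n b<n
  ... | inj₂ (last , refl) = hue-last (≤-pred (subst (3 ≤_) (sym last) 3≤n)) a<n

  spokeHue : Fin n ⊎ Fin n → ℕ
  spokeHue (inj₁ i) = hue (toℕ i) (toℕ i)
  spokeHue (inj₂ i) = hue (suc (toℕ i)) (toℕ i)

  spokeHue≤m : ∀ z → spokeHue z ≤ m
  spokeHue≤m (inj₁ i) = hue≤m (toℕ i) (toℕ<n i)
  spokeHue≤m (inj₂ i) = hue≤m (suc (toℕ i)) (toℕ<n i)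

  vertexHue : Fin (n + n) → ℕ
  vertexHue x = spokeHue (splitAt n x)

  color : Fin (n + n) → Fin (m + 1)
  color x = fromℕ< (≤-<-trans (spokeHue≤m (splitAt n x)) (m<m+n m (s≤s z≤n)))

  toℕ-color : ∀ x → toℕ (color x) ≡ vertexHue x
  toℕ-color x = toℕ-fromℕ< _

  sameColor⇒sameHue : ∀ {x y} → color x ≡ color y → vertexHue x ≡ vertexHue y
  sameColor⇒sameHue {x} {y} e = trans (sym (toℕ-color x)) (trans (cong toℕ e) (toℕ-color y))

  vertexHue-base : ∀ i → vertexHue (base G i) ≡ hue (toℕ i) (toℕ i)
  vertexHue-base i = cong spokeHue (splitAt-↑ˡ n i n)

  vertexHue-pendant : ∀ i → vertexHue (pendant G i) ≡ hue (suc (toℕ i)) (toℕ i)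
  vertexHue-pendant i = cong spokeHue (splitAt-↑ʳ n n i)

  adjacent-hues-differ : ∀ {x y} → (∃ λ i → Spoke G i x) → (∃ λ j → Spoke G j y) →
                         adj (corona G) x y ≡ true → vertexHue x ≢ vertexHue y
  adjacent-hues-differ (i , inj₁ refl) (j , inj₁ refl) x~y rewrite vertexHue-base i | vertexHue-base j
    with ∨≡true⁻ (succMod n (toℕ i) (toℕ j)) (trans (sym (adj-base-base G i j)) x~y)
  ... | inj₁ i→j = cycle-hue-distinct (toℕ<n i) (toℕ<n j) i→j
  ... | inj₂ j→i = cycle-hue-distinct (toℕ<n j) (toℕ<n i) j→i ∘ sym
  adjacent-hues-differ (i , inj₁ refl) (j , inj₂ refl) x~y rewrite vertexHue-base i | vertexHue-pendant j
    with toWitness′ (trans (sym (adj-base-pendant G i j)) x~y)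
  ... | refl = hue-consecutive (toℕ i) (toℕ<n i) (toℕ<n i)
  adjacent-hues-differ (i , inj₂ refl) (j , inj₁ refl) x~y rewrite vertexHue-pendant i | vertexHue-base j
    with toWitness′ (trans (sym (adj-pendant-base G i j)) x~y)
  ... | refl = hue-consecutive (toℕ i) (toℕ<n i) (toℕ<n i) ∘ sym
  adjacent-hues-differ (i , inj₂ refl) (j , inj₂ refl) x~y =
    contradiction (trans (sym (adj-pendant-pendant G i j)) x~y) λ ()

  proper : Proper (corona G) color
  proper x y x~y = adjacent-hues-differ (corona-spoke G x) (corona-spoke G y) x~y ∘ sameColor⇒sameHue

  smallHue-in-spoke : ∀ i → ∃ λ u → Spoke G i u × vertexHue u < m
  smallHue-in-spoke i with isEven (toℕ i) in e
  ... | true  = base G i , inj₁ refl ,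
                subst (_< m) (sym (trans (vertexHue-base i) (hue-even (toℕ i) (toℕ i) e))) half<m
    where
    half<m = ⌊a/2⌋<⌈n/2⌉ (toℕ<n i)
  ... | false = pendant G i , inj₂ refl ,
                subst (_< m) (sym (trans (vertexHue-pendant i) (hue-even (suc (toℕ i)) (toℕ i) odd))) half<m
    where
    half<m = ⌊a/2⌋<⌈n/2⌉ (toℕ<n i)
    odd : isEven (suc (toℕ i)) ≡ true
    odd = trans (isEven-suc (toℕ i)) (cong not e)

  smallHue-base-injective : ∀ {i j} → vertexHue (base G i) ≡ vertexHue (base G j) →
                            vertexHue (base G i) < m → i ≡ j
  smallHue-base-injective {i} {j} eq hue<m rewrite vertexHue-base i | vertexHue-base j
    with hue-injective (toℕ i) (toℕ i) (toℕ j) (toℕ j) eq hue<m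
  ... | even-i , even-j , halves = toℕ-injective (⌊/2⌋-isEven-injective _ _ halves (trans even-i (sym even-j)))

  smallHue-pendant-injective : ∀ {i j} → vertexHue (pendant G i) ≡ vertexHue (pendant G j) →
                               vertexHue (pendant G i) < m → i ≡ j
  smallHue-pendant-injective {i} {j} eq hue<m rewrite vertexHue-pendant i | vertexHue-pendant j
    with hue-injective (suc (toℕ i)) (toℕ i) (suc (toℕ j)) (toℕ j) eq hue<m
  ... | even-i , even-j , halves = toℕ-injective (⌊/2⌋-isEven-injective _ _ halves
          (not-injective (trans (sym (isEven-suc (toℕ i))) (trans (trans even-i (sym even-j)) (isEven-suc (toℕ j))))))

  smallHue-class≤2 : ∀ u → vertexHue u < m → classSize color (color u) ≤ 2
  smallHue-class≤2 u hue<m = begin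
    classSize color (color u)                          ≡⟨ count-++ n _ ⟩
    count (λ i → ⌊ color (base G i) ≟ color u ⌋) +
      count (λ i → ⌊ color (pendant G i) ≟ color u ⌋)  ≤⟨ +-mono-≤ (count-≤1 _ base-unique) (count-≤1 _ pendant-unique) ⟩
    2                                                  ∎
    where
    open ≤-Reasoning
    hue≡ : ∀ {x} → ⌊ color x ≟ color u ⌋ ≡ true → vertexHue x ≡ vertexHue u
    hue≡ e = sameColor⇒sameHue (toWitness′ e)

    small-at : ∀ {x} → ⌊ color x ≟ color u ⌋ ≡ true → vertexHue x < m
    small-at e = subst (_< m) (sym (hue≡ e)) hue<m

    base-unique : ∀ {i j} → ⌊ color (base G i) ≟ color u ⌋ ≡ true → ⌊ color (base G j) ≟ color u ⌋ ≡ true → i ≡ j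
    base-unique ei ej = smallHue-base-injective (trans (hue≡ ei) (sym (hue≡ ej))) (small-at ei)

    pendant-unique : ∀ {i j} → ⌊ color (pendant G i) ≟ color u ⌋ ≡ true → ⌊ color (pendant G j) ≟ color u ⌋ ≡ true → i ≡ j
    pendant-unique ei ej = smallHue-pendant-injective (trans (hue≡ ei) (sym (hue≡ ej))) (small-at ei)

  md : MajorityDominating (corona G) color
  md x with corona-spoke G x
  ... | i , x∈spoke with smallHue-in-spoke i
  ...   | u , u∈spoke , hue<m =
    majorityDominated-by-small-class (corona G) color (closedNbhd-spoke G x∈spoke u∈spoke) (smallHue-class≤2 u hue<m)

  nonempty : AllClassesNonempty (corona G) color
  nonempty t with m≤n⇒m<n∨m≡n (≤-pred (subst (suc (toℕ t) ≤_) (+-comm m 1) (toℕ<n t)))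
  ... | inj₁ t<m = base G w , toℕ-injective (begin
      toℕ (color (base G w))  ≡⟨ toℕ-color (base G w) ⟩
      vertexHue (base G w)    ≡⟨ vertexHue-base w ⟩
      hue (toℕ w) (toℕ w)     ≡⟨ cong (λ a → hue a a) (toℕ-fromℕ< (j<⌈n/2⌉⇒j+j<n n t<m)) ⟩
      hue (j + j) (j + j)     ≡⟨ hue-even (j + j) (j + j) (isEven-double j) ⟩
      ⌊ j + j /2⌋             ≡⟨ n≡⌊n+n/2⌋ j ⟨
      j                       ∎)
    where
    open ≡-Reasoning
    j = toℕ t
    w = fromℕ< (j<⌈n/2⌉⇒j+j<n n t<m)
  ... | inj₂ t≡m = pendant G w , toℕ-injective (begin
      toℕ (color (pendant G w))  ≡⟨ toℕ-color (pendant G w) ⟩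
      vertexHue (pendant G w)    ≡⟨ vertexHue-pendant w ⟩
      hue (suc (toℕ w)) (toℕ w)  ≡⟨ cong (λ a → hue (suc a) a) (toℕ-fromℕ< 0<n) ⟩
      m                          ≡⟨ t≡m ⟨
      toℕ t                      ∎)
    where
    open ≡-Reasoning
    0<n : 0 < n
    0<n = ≤-trans (s≤s z≤n) 3≤n
    w = fromℕ< 0<n

  hasMDColoring : HasMDColoring (corona G) (m + 1)
  hasMDColoring = color , proper , nonempty , md

proposition3p1 : (n : ℕ) → 3 ≤ n → χmd≡ (corona (Cycle n)) (⌈ n /2⌉ + 1)
proposition3p1 n 3≤n =
  CycleColoring.hasMDColoring n 3≤n , hasMDColoring-corona-≥ (Cycle n) (≤-trans (n≤1+n 2) 3≤n)
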